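{- Let $(P,\leq)$ be a poset and $f,g \in \operatorname{Aut}(P)$. If $\gamma : P_f \rightharpoonup P_g$ is a finite partial $L$-isomorphism (an $L$-isomorphism between finite substructures), then $\gamma$ extends uniquely to an $L$-isomorphism $h : f^{\mathbb{Z}}[\operatorname{dom}(\gamma)] \to g^{\mathbb{Z}}[\operatorname{ran}(\gamma)]$ between these substructures of $P_f$ and $P_g$.
   Context: $L = \{b_i : i \in \mathbb{Z}\}$ is a language of binary relation symbols. For a poset $P$ and $f \in \operatorname{Aut}(P)$, $P_f$ is the $L$-structure with universe $P$ in which $b_i^f(x,y)$ holds iff $x \leq f^i(y)$. For $S \subseteq P$, $f^{\mathbb{Z}}[S] = \bigcup_{n \in \mathbb{Z}} f^n[S]$. -}

module Defs where

open import Level using (Level; _⊔_; suc)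
open import Data.Nat using (ℕ; zero) renaming (suc to sucℕ)
open import Data.Integer using (ℤ; +_; -[1+_])
open import Data.Product using (Σ; ∃; _×_; _,_; proj₁)
open import Data.List using (List)
open import Data.List.Membership.Propositional using (_∈_)
open import Relation.Binary.Core using (Rel)
open import Relation.Binary.Structures using (IsPartialOrder)
open import Relation.Binary.PropositionalEquality using (_≡_)
open import Relation.Unary using (Pred)
open import Function.Bundles using (_⇔_)

record Aut {a ℓ : Level} (P : Set a) (_≤_ : Rel P ℓ) : Set (a ⊔ ℓ) where
  field
    to        : P → P
    from      : P → P
    to-from   : ∀ x → to (from x) ≡ x
    from-to   : ∀ x → from (to x) ≡ x
    mono      : ∀ x y → (x ≤ y) ⇔ (to x ≤ to y)

module Structures {a ℓ : Level} {P : Set a} (_≤_ : Rel P ℓ) where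

  iter : (P → P) → ℕ → P → P
  iter h zero     x = x
  iter h (sucℕ n) x = h (iter h n x)

  pow : Aut P _≤_ → ℤ → P → P
  pow f (+ n)      = iter (Aut.to f) n
  pow f -[1+ n ]   = iter (Aut.from f) (sucℕ n)

  b : Aut P _≤_ → ℤ → P → P → Set ℓ
  b f i x y = x ≤ pow f i y

  Finite : {ℓ' : Level} → Pred P ℓ' → Set (a ⊔ ℓ')
  Finite S = Σ (List P) λ xs → ∀ x → S x → x ∈ xs

  orbit : {ℓ' : Level} → Aut P _≤_ → Pred P ℓ' → Pred P (a ⊔ ℓ')
  orbit f S x = ∃ λ (n : ℤ) → ∃ λ d → S d × x ≡ pow f n d

  Sub : {ℓ' : Level} → Pred P ℓ' → Set (a ⊔ ℓ')
  Sub S = Σ P S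

  -- Elements of a substructure are identified
  -- by their underlying point of P (membership proofs are irrelevant).
  record IsLIso {ℓ₁ ℓ₂ : Level} (f g : Aut P _≤_) (S : Pred P ℓ₁) (T : Pred P ℓ₂)
                (h : Sub S → Sub T) : Set (a ⊔ ℓ ⊔ ℓ₁ ⊔ ℓ₂) where
    field
      well-defined : ∀ (u v : Sub S) → proj₁ u ≡ proj₁ v → proj₁ (h u) ≡ proj₁ (h v)
      injective    : ∀ (u v : Sub S) → proj₁ (h u) ≡ proj₁ (h v) → proj₁ u ≡ proj₁ v
      surjective   : ∀ (t : Sub T) → ∃ λ (u : Sub S) → proj₁ (h u) ≡ proj₁ t
      preserves    : ∀ (i : ℤ) (u v : Sub S) →
                       b f i (proj₁ u) (proj₁ v) ⇔ b g i (proj₁ (h u)) (proj₁ (h v))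

  Extends : {ℓ₁ ℓ₂ ℓ₃ : Level} (f : Aut P _≤_) {D : Pred P ℓ₁} {R : Pred P ℓ₂} {T : Pred P ℓ₃}
            → (γ : Sub D → Sub R) → (h : Sub (orbit f D) → Sub T) → Set (a ⊔ ℓ₁)
  Extends f {D} γ h = ∀ x (p : D x) (q : orbit f D x) → proj₁ (h (x , q)) ≡ proj₁ (γ (x , p))

module Submission where

open import Defs
open import Level using (Level)
open import Data.Product using (Σ; ∃; _×_; _,_; proj₁; proj₂)
open import Data.Nat using (zero; suc)
open import Data.Integer using (ℤ; +_; -[1+_]; _+_; -_; 1ℤ; -1ℤ)
open import Data.Integer.Properties using (+-assoc; +-identityˡ; +-inverseˡ; +-inverseʳ)
open import Relation.Binary.Core using (Rel)
open import Relation.Binary.Structures using (IsPartialOrder)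
open import Relation.Binary.PropositionalEquality
  using (_≡_; refl; sym; trans; cong; subst; subst₂; module ≡-Reasoning)
open import Relation.Unary using (Pred)
open import Function.Bundles using (_⇔_; Equivalence)
open import Function.Construct.Identity using (⇔-id)
open import Function.Construct.Symmetry using (⇔-sym)
open import Function.Construct.Composition using (_⇔-∘_)

-- The b_i-diagram of P_f is generated by f and ≤, so a partial isomorphism
-- γ : d ↦ γ d forces fⁿ d ↦ gⁿ (γ d); the shift identity
-- fⁿ x ≤ fⁱ (fᵐ y) ⇔ x ≤ f^(i + m − n) y reduces every relation between orbit
-- points to a relation between points of dom γ, where γ preserves it.

module Powers {a ℓ : Level} {P : Set a} {_≤_ : Rel P ℓ} (f : Aut P _≤_) where
  open Structures _≤_
  open Aut f

  from-mono : ∀ x y → (x ≤ y) ⇔ (from x ≤ from y)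
  from-mono x y =
    ⇔-sym (subst₂ (λ u v → (from x ≤ from y) ⇔ (u ≤ v)) (to-from x) (to-from y)
             (mono (from x) (from y)))

  iter-mono : ∀ {h : P → P} → (∀ x y → (x ≤ y) ⇔ (h x ≤ h y)) →
              ∀ n x y → (x ≤ y) ⇔ (iter h n x ≤ iter h n y)
  iter-mono h-mono zero    x y = ⇔-id _
  iter-mono h-mono (suc n) x y = h-mono _ _ ⇔-∘ iter-mono h-mono n x y

  pow-mono : ∀ i x y → (x ≤ y) ⇔ (pow f i x ≤ pow f i y)
  pow-mono (+ n)    = iter-mono mono n
  pow-mono -[1+ n ] = iter-mono from-mono (suc n)

  pow-1+ : ∀ i x → pow f (1ℤ + i) x ≡ to (pow f i x)
  pow-1+ (+ n)          x = refl
  pow-1+ -[1+ zero ]    x = sym (to-from x)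
  pow-1+ -[1+ suc n ]   x = sym (to-from _)

  pow-[-1]+ : ∀ i x → pow f (-1ℤ + i) x ≡ from (pow f i x)
  pow-[-1]+ (+ zero)  x = refl
  pow-[-1]+ (+ suc n) x = sym (from-to _)
  pow-[-1]+ -[1+ n ]  x = refl

  pow-+ : ∀ i j x → pow f (i + j) x ≡ pow f i (pow f j x)
  pow-+ (+ zero) j x = cong (λ k → pow f k x) (+-identityˡ j)
  pow-+ (+ suc n) j x = begin
    pow f (1ℤ + + n + j) x   ≡⟨ cong (λ k → pow f k x) (+-assoc 1ℤ (+ n) j) ⟩
    pow f (1ℤ + (+ n + j)) x ≡⟨ pow-1+ (+ n + j) x ⟩
    to (pow f (+ n + j) x)   ≡⟨ cong to (pow-+ (+ n) j x) ⟩
    to (pow f (+ n) (pow f j x)) ∎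
    where open ≡-Reasoning
  pow-+ -[1+ zero ] j x = pow-[-1]+ j x
  pow-+ -[1+ suc n ] j x = begin
    pow f (-1ℤ + -[1+ n ] + j) x   ≡⟨ cong (λ k → pow f k x) (+-assoc -1ℤ -[1+ n ] j) ⟩
    pow f (-1ℤ + (-[1+ n ] + j)) x ≡⟨ pow-[-1]+ (-[1+ n ] + j) x ⟩
    from (pow f (-[1+ n ] + j) x)  ≡⟨ cong from (pow-+ -[1+ n ] j x) ⟩
    from (pow f -[1+ n ] (pow f j x)) ∎
    where open ≡-Reasoning

  pow-inverseˡ : ∀ i x → pow f (- i) (pow f i x) ≡ x
  pow-inverseˡ i x = trans (sym (pow-+ (- i) i x)) (cong (λ k → pow f k x) (+-inverseˡ i))

  pow-inverseʳ : ∀ i x → pow f i (pow f (- i) x) ≡ x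
  pow-inverseʳ i x = trans (sym (pow-+ i (- i) x)) (cong (λ k → pow f k x) (+-inverseʳ i))

  b-pow : ∀ i n m x y → b f i (pow f n x) (pow f m y) ⇔ b f (- n + (i + m)) x y
  b-pow i n m x y =
    ⇔-sym (subst (λ z → (x ≤ pow f j y) ⇔ (pow f n x ≤ z)) shift (pow-mono n x (pow f j y)))
    where
    j : ℤ
    j = - n + (i + m)
    shift : pow f n (pow f j y) ≡ pow f i (pow f m y)
    shift = begin
      pow f n (pow f j y)     ≡⟨ pow-+ n j y ⟨
      pow f (n + j) y         ≡⟨ cong (λ k → pow f k y) n+j≡i+m ⟩
      pow f (i + m) y         ≡⟨ pow-+ i m y ⟩
      pow f i (pow f m y)     ∎
      where
      open ≡-Reasoning
      n+j≡i+m : n + j ≡ i + m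
      n+j≡i+m = begin
        n + (- n + (i + m)) ≡⟨ +-assoc n (- n) (i + m) ⟨
        n + - n + (i + m)   ≡⟨ cong (_+ (i + m)) (+-inverseʳ n) ⟩
        + 0 + (i + m)       ≡⟨ +-identityˡ (i + m) ⟩
        i + m               ∎

module LIso {a ℓ : Level} {P : Set a} {_≤_ : Rel P ℓ}
            (po : IsPartialOrder _≡_ _≤_) (f g : Aut P _≤_) where
  open Structures _≤_
  open IsPartialOrder po using (reflexive; antisym)
  open Equivalence using () renaming (to to ⇔-to; from to ⇔-from)

  -- b₀ is ≤ itself, so preserving it forces well-definedness and injectivity.
  preserves⇒IsLIso : ∀ {ℓ₁ ℓ₂} {S : Pred P ℓ₁} {T : Pred P ℓ₂} (h : Sub S → Sub T) →
    (∀ i u v → b f i (proj₁ u) (proj₁ v) ⇔ b g i (proj₁ (h u)) (proj₁ (h v))) →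
    (∀ (t : Sub T) → ∃ λ (u : Sub S) → proj₁ (h u) ≡ proj₁ t) →
    IsLIso f g S T h
  preserves⇒IsLIso h pres surj = record
    { well-defined = λ u v e → antisym (⇔-to (pres (+ 0) u v) (reflexive e))
                                       (⇔-to (pres (+ 0) v u) (reflexive (sym e)))
    ; injective    = λ u v e → antisym (⇔-from (pres (+ 0) u v) (reflexive e))
                                       (⇔-from (pres (+ 0) v u) (reflexive (sym e)))
    ; surjective   = surj
    ; preserves    = pres
    }

  pow-equivariant : ∀ {ℓ₁ ℓ₂} {S : Pred P ℓ₁} {T : Pred P ℓ₂} {h : Sub S → Sub T} →
    IsLIso f g S T h →
    ∀ n u v → proj₁ u ≡ pow f n (proj₁ v) → proj₁ (h u) ≡ pow g n (proj₁ (h v))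
  pow-equivariant {h = h} iso n u v u≡fⁿv = antisym hu≤gⁿhv gⁿhv≤hu
    where
    open IsLIso iso using (preserves)
    hu≤gⁿhv : proj₁ (h u) ≤ pow g n (proj₁ (h v))
    hu≤gⁿhv = ⇔-to (preserves n u v) (reflexive u≡fⁿv)
    v≡f⁻ⁿu : proj₁ v ≡ pow f (- n) (proj₁ u)
    v≡f⁻ⁿu = trans (sym (Powers.pow-inverseˡ f n _)) (cong (pow f (- n)) (sym u≡fⁿv))
    hv≤g⁻ⁿhu : proj₁ (h v) ≤ pow g (- n) (proj₁ (h u))
    hv≤g⁻ⁿhu = ⇔-to (preserves (- n) v u) (reflexive v≡f⁻ⁿu)
    gⁿhv≤hu : pow g n (proj₁ (h v)) ≤ proj₁ (h u)
    gⁿhv≤hu = subst₂ _≤_ refl (Powers.pow-inverseʳ g n _)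
                (⇔-to (Powers.pow-mono g n _ _) hv≤g⁻ⁿhu)

  S⊆orbit : ∀ {ℓ₁} {φ : Aut P _≤_} {S : Pred P ℓ₁} {x : P} → S x → orbit φ S x
  S⊆orbit {x = x} p = + 0 , x , p , refl

  module OrbitExtension {ℓ₁ ℓ₂ : Level} {D : Pred P ℓ₁} {R : Pred P ℓ₂}
                        (γ : Sub D → Sub R) (iso : IsLIso f g D R γ) where
    open IsLIso iso using (preserves; surjective)

    extension : Sub (orbit f D) → Sub (orbit g R)
    extension (_ , n , d , p , _) =
      pow g n (proj₁ (γ (d , p))) , n , _ , proj₂ (γ (d , p)) , refl

    extension-preserves : ∀ i u v →
      b f i (proj₁ u) (proj₁ v) ⇔ b g i (proj₁ (extension u)) (proj₁ (extension v))
    extension-preserves i (_ , n , d , p , refl) (_ , m , d′ , p′ , refl) =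
      ⇔-sym (Powers.b-pow g i n m _ _)
        ⇔-∘ (preserves (- n + (i + m)) (d , p) (d′ , p′) ⇔-∘ Powers.b-pow f i n m d d′)

    extension-surjective : ∀ (t : Sub (orbit g R)) →
                           ∃ λ (u : Sub (orbit f D)) → proj₁ (extension u) ≡ proj₁ t
    extension-surjective (_ , n , r , q , refl) with surjective (r , q)
    ... | (d , p) , γd≡r = (pow f n d , n , d , p , refl) , cong (pow g n) γd≡r

    extension-isLIso : IsLIso f g (orbit f D) (orbit g R) extension
    extension-isLIso = preserves⇒IsLIso extension extension-preserves extension-surjective

    extension-extends : Extends f γ extension
    extension-extends x p q =
      IsLIso.well-defined extension-isLIso (x , q) (x , S⊆orbit p) refl

    extension-unique : ∀ (h : Sub (orbit f D) → Sub (orbit g R)) →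
                       IsLIso f g (orbit f D) (orbit g R) h → Extends f γ h →
                       ∀ u → proj₁ (h u) ≡ proj₁ (extension u)
    extension-unique h h-iso h-extends u@(_ , n , d , p , refl) = begin
      proj₁ (h u)                         ≡⟨ pow-equivariant h-iso n u (d , S⊆orbit p) refl ⟩
      pow g n (proj₁ (h (d , S⊆orbit p))) ≡⟨ cong (pow g n) (h-extends d p (S⊆orbit p)) ⟩
      pow g n (proj₁ (γ (d , p)))         ∎
      where open ≡-Reasoning

mainTheorem12 : {a ℓ ℓ₁ ℓ₂ : Level} {P : Set a} {_≤_ : Rel P ℓ}
    → IsPartialOrder _≡_ _≤_
    → (f g : Aut P _≤_)
    → (D : Pred P ℓ₁) (R : Pred P ℓ₂)
    → Structures.Finite _≤_ D → Structures.Finite _≤_ R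
    → (γ : Structures.Sub _≤_ D → Structures.Sub _≤_ R)
    → Structures.IsLIso _≤_ f g D R γ
    → Σ (Structures.Sub _≤_ (Structures.orbit _≤_ f D) → Structures.Sub _≤_ (Structures.orbit _≤_ g R)) λ h
        → Structures.IsLIso _≤_ f g (Structures.orbit _≤_ f D) (Structures.orbit _≤_ g R) h
          × Structures.Extends _≤_ f γ h
          × (∀ (h' : Structures.Sub _≤_ (Structures.orbit _≤_ f D) → Structures.Sub _≤_ (Structures.orbit _≤_ g R))
             → Structures.IsLIso _≤_ f g (Structures.orbit _≤_ f D) (Structures.orbit _≤_ g R) h'
             → Structures.Extends _≤_ f γ h'
             → ∀ u → proj₁ (h' u) ≡ proj₁ (h u))
mainTheorem12 po f g D R _ _ γ iso =
  extension , extension-isLIso , extension-extends , extension-unique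
  where open LIso.OrbitExtension po f g γ iso
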